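{- Let $\varphi$ be a propositional formula built from atoms using only the connectives $\wedge$ and $\vee$ (no negations), in which no atom occurs more than once. Let $\varphi^D$ be the disjunctive normal form of $\varphi$ obtained by distributing conjunctions over disjunctions. Then for any two distinct atoms $e_i,e_j$ of $\varphi$, there is a clause (conjunct of atoms) of $\varphi^D$ containing both $e_i$ and $e_j$ if and only if $J(e_i,e_j)=\wedge$.
   Context: The parse tree of $\varphi$ has the atoms as leaves and internal nodes labeled $\wedge$ or $\vee$. For two leaves $e_i,e_j$, the joining operand $J(e_i,e_j)$ is the Boolean operator labeling their lowest common ancestor node in the parse tree. -}

module Defs where

open import Data.Nat using (ℕ)
open import Data.Nat.Properties using (_≟_)
open import Data.List using (List; []; _∷_; _++_; concatMap; map)
open import Data.List.Membership.DecPropositional _≟_ using (_∈?_)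
open import Data.Bool using (Bool; true; false; _∧_; _∨_)
open import Data.Maybe using (Maybe; just; nothing)
open import Relation.Nullary.Decidable using (⌊_⌋)

data Op : Set where
  AND OR : Op

data Formula : Set where
  atom : ℕ → Formula
  node : Op → Formula → Formula → Formula

atoms : Formula → List ℕ
atoms (atom a)     = a ∷ []
atoms (node _ p q) = atoms p ++ atoms q

-- A DNF is a list of clauses; a clause is a list of atoms (a conjunction).
DNF : Set
DNF = List (List ℕ)

dnf : Formula → DNF
dnf (atom a)        = (a ∷ []) ∷ []
dnf (node OR  p q)  = dnf p ++ dnf q
dnf (node AND p q)  = concatMap (λ c → map (λ d → c ++ d) (dnf q)) (dnf p)

occurs : ℕ → Formula → Bool
occurs a φ = ⌊ a ∈? atoms φ ⌋

-- Joining operand J(a,b): the operator labelling the lowest common ancestor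
-- of the leaves a and b in the parse tree (nothing if a or b does not occur,
-- or if a and b are the same single leaf).
join : Formula → ℕ → ℕ → Maybe Op
join (atom _) a b = nothing
join (node o p q) a b with occurs a p | occurs b p | occurs a q | occurs b q
... | true  | true  | _     | _     = join p a b
... | _     | _     | true  | true  = join q a b
... | true  | false | false | true  = just o
... | false | true  | true  | false = just o
... | _     | _     | _     | _     = nothing

-- Distribution sends ∨ to the concatenation of the two clause lists and ∧ to
-- all concatenations c ++ d of a clause c of the left operand with a clause d of
-- the right one; in particular every clause of a subformula consists of its own
-- atoms. By uniqueness of atoms, two distinct atoms under a node either lie in the
-- same operand, where both the clauses containing them and the joining operand
-- are those of that operand, or in different operands. In the latter case an
-- ∨-node keeps them in different clauses, while an ∧-node glues a clause
-- containing one to a clause containing the other.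

module Submission where

open import Defs
open import Data.Bool using (true; false)
open import Data.Nat using (ℕ; _≟_)
open import Data.List using (List; []; _∷_; _++_; concatMap; map; cartesianProductWith)
open import Data.List.Membership.Propositional using (_∈_; _∉_; find; lose)
open import Data.List.Membership.Propositional.Properties
  using (∈-++⁺ˡ; ∈-++⁺ʳ; ∈-++⁻; ∈-cartesianProductWith⁺; ∈-cartesianProductWith⁻)
open import Data.List.Membership.DecPropositional _≟_ using (_∈?_)
open import Data.List.Relation.Binary.Subset.Propositional using (_⊆_)
open import Data.List.Relation.Binary.Subset.Propositional.Properties
  using (⊆-refl; xs⊆xs++ys; xs⊆ys++xs; ++⁺)
open import Data.List.Relation.Binary.Disjoint.Propositional using (Disjoint)
open import Data.List.Relation.Unary.Any as Any using (Any; here; there)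
import Data.List.Relation.Unary.Any.Properties as Anyₚ
import Data.List.Relation.Unary.All as All
open import Data.List.Relation.Unary.All.Properties using (++⁻ˡ; ++⁻ʳ)
open import Data.List.Relation.Unary.AllPairs using (_∷_)
open import Data.List.Relation.Unary.Unique.Propositional using (Unique; [])
open import Data.Maybe using (just)
open import Data.Product using (_×_; _,_; proj₁; proj₂; ∃; ∃₂; swap)
open import Data.Sum using (inj₁; inj₂)
open import Data.Empty using (⊥-elim)
open import Function.Base using (_∘′_)
open import Function.Bundles using (_⇔_; mk⇔)
open import Function.Properties.Equivalence using () renaming (trans to ⇔-trans)
open import Relation.Nullary.Decidable using (isYes≗does; dec-true; dec-false)
open import Relation.Binary.PropositionalEquality
  using (_≡_; _≢_; refl; sym; trans; cong; subst)

Unique-++⁻ : ∀ {a} {A : Set a} (xs : List A) {ys : List A} →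
  Unique (xs ++ ys) → Unique xs × Unique ys × Disjoint xs ys
Unique-++⁻ []       u                = [] , u , λ ()
Unique-++⁻ (x ∷ xs) (x∉xs++ys ∷ u) with Unique-++⁻ xs u
... | uxs , uys , xs#ys = ++⁻ˡ xs x∉xs++ys ∷ uxs , uys , disjoint
  where
  disjoint : Disjoint (x ∷ xs) _
  disjoint (here refl , v∈ys) = All.lookup (++⁻ʳ xs x∉xs++ys) v∈ys refl
  disjoint (there v∈xs , v∈ys) = xs#ys (v∈xs , v∈ys)

Disjoint⇒∉ʳ : ∀ {a} {A : Set a} {xs ys : List A} {x} → Disjoint xs ys → x ∈ xs → x ∉ ys
Disjoint⇒∉ʳ xs#ys x∈xs x∈ys = xs#ys (x∈xs , x∈ys)

Disjoint⇒∉ˡ : ∀ {a} {A : Set a} {xs ys : List A} {x} → Disjoint xs ys → x ∈ ys → x ∉ xs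
Disjoint⇒∉ˡ xs#ys x∈ys x∈xs = xs#ys (x∈xs , x∈ys)

concatMap-map≡cartesianProductWith : ∀ {a b c} {A : Set a} {B : Set b} {C : Set c}
  (f : A → B → C) (xs : List A) (ys : List B) →
  concatMap (λ x → map (f x) ys) xs ≡ cartesianProductWith f xs ys
concatMap-map≡cartesianProductWith f []       ys = refl
concatMap-map≡cartesianProductWith f (x ∷ xs) ys =
  cong (map (f x) ys ++_) (concatMap-map≡cartesianProductWith f xs ys)

∈-++∧∉ʳ⇒∈ˡ : ∀ {a} {A : Set a} {x : A} (xs : List A) {ys} → x ∈ xs ++ ys → x ∉ ys → x ∈ xs
∈-++∧∉ʳ⇒∈ˡ xs x∈ x∉ys with ∈-++⁻ xs x∈
... | inj₁ x∈xs = x∈xs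
... | inj₂ x∈ys = ⊥-elim (x∉ys x∈ys)

∈-++∧∉ˡ⇒∈ʳ : ∀ {a} {A : Set a} {x : A} (xs : List A) {ys} → x ∈ xs ++ ys → x ∉ xs → x ∈ ys
∈-++∧∉ˡ⇒∈ʳ xs x∈ x∉xs with ∈-++⁻ xs x∈
... | inj₁ x∈xs = ⊥-elim (x∉xs x∈xs)
... | inj₂ x∈ys = x∈ys

dnf-∧ : ∀ p q → dnf (node AND p q) ≡ cartesianProductWith _++_ (dnf p) (dnf q)
dnf-∧ p q = concatMap-map≡cartesianProductWith _++_ (dnf p) (dnf q)

∈-dnf-∧⁺ : ∀ p q {c d} → c ∈ dnf p → d ∈ dnf q → c ++ d ∈ dnf (node AND p q)
∈-dnf-∧⁺ p q c∈ d∈ = subst (_ ∈_) (sym (dnf-∧ p q)) (∈-cartesianProductWith⁺ _++_ c∈ d∈)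

∈-dnf-∧⁻ : ∀ p q {e} → e ∈ dnf (node AND p q) →
  ∃₂ λ c d → c ∈ dnf p × d ∈ dnf q × e ≡ c ++ d
∈-dnf-∧⁻ p q e∈ =
  ∈-cartesianProductWith⁻ _++_ (dnf p) (dnf q) (subst (_ ∈_) (dnf-∧ p q) e∈)

dnf-nonempty : ∀ φ → ∃ λ c → c ∈ dnf φ
dnf-nonempty (atom a)       = _ , here refl
dnf-nonempty (node OR p q)  = let c , c∈ = dnf-nonempty p in c , ∈-++⁺ˡ c∈
dnf-nonempty (node AND p q) =
  let c , c∈ = dnf-nonempty p; d , d∈ = dnf-nonempty q in c ++ d , ∈-dnf-∧⁺ p q c∈ d∈

clause⊆atoms : ∀ φ {c} → c ∈ dnf φ → c ⊆ atoms φ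
clause⊆atoms (atom a) (here refl) = ⊆-refl
clause⊆atoms (node OR p q) c∈ with ∈-++⁻ (dnf p) c∈
... | inj₁ c∈p = xs⊆xs++ys (atoms p) (atoms q) ∘′ clause⊆atoms p c∈p
... | inj₂ c∈q = xs⊆ys++xs (atoms q) (atoms p) ∘′ clause⊆atoms q c∈q
clause⊆atoms (node AND p q) e∈ with ∈-dnf-∧⁻ p q e∈
... | c , d , c∈ , d∈ , refl = ++⁺ (clause⊆atoms p c∈) (clause⊆atoms q d∈)

atom∈clause : ∀ φ {a} → a ∈ atoms φ → ∃ λ c → c ∈ dnf φ × a ∈ c
atom∈clause (atom a) (here refl) = _ , here refl , here refl
atom∈clause (node o p q) a∈ with o | ∈-++⁻ (atoms p) a∈
... | OR  | inj₁ a∈p = let c , c∈ , a∈c = atom∈clause p a∈p in c , ∈-++⁺ˡ c∈ , a∈c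
... | OR  | inj₂ a∈q = let c , c∈ , a∈c = atom∈clause q a∈q in c , ∈-++⁺ʳ (dnf p) c∈ , a∈c
... | AND | inj₁ a∈p =
  let c , c∈ , a∈c = atom∈clause p a∈p; d , d∈ = dnf-nonempty q
  in c ++ d , ∈-dnf-∧⁺ p q c∈ d∈ , ∈-++⁺ˡ a∈c
... | AND | inj₂ a∈q =
  let c , c∈ = dnf-nonempty p; d , d∈ , a∈d = atom∈clause q a∈q
  in c ++ d , ∈-dnf-∧⁺ p q c∈ d∈ , ∈-++⁺ʳ c a∈d

occurs-∈ : ∀ {a} φ → a ∈ atoms φ → occurs a φ ≡ true
occurs-∈ {a} φ a∈ = trans (isYes≗does (a ∈? atoms φ)) (dec-true (a ∈? atoms φ) a∈)

occurs-∉ : ∀ {a} φ → a ∉ atoms φ → occurs a φ ≡ false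
occurs-∉ {a} φ a∉ = trans (isYes≗does (a ∈? atoms φ)) (dec-false (a ∈? atoms φ) a∉)

join-inˡ : ∀ o p q {a b} → a ∈ atoms p → b ∈ atoms p → join (node o p q) a b ≡ join p a b
join-inˡ o p q a∈p b∈p rewrite occurs-∈ p a∈p | occurs-∈ p b∈p = refl

join-inʳ : ∀ o p q {a b} → a ∉ atoms p → a ∈ atoms q → b ∈ atoms q →
  join (node o p q) a b ≡ join q a b
join-inʳ o p q a∉p a∈q b∈q rewrite occurs-∉ p a∉p | occurs-∈ q a∈q | occurs-∈ q b∈q = refl

join-across : ∀ o p q {a b} → a ∈ atoms p → b ∉ atoms p → a ∉ atoms q → b ∈ atoms q →
  join (node o p q) a b ≡ just o
join-across o p q a∈p b∉p a∉q b∈q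
  rewrite occurs-∈ p a∈p | occurs-∉ p b∉p | occurs-∉ q a∉q | occurs-∈ q b∈q = refl

join-across′ : ∀ o p q {a b} → a ∉ atoms p → b ∈ atoms p → a ∈ atoms q → b ∉ atoms q →
  join (node o p q) a b ≡ just o
join-across′ o p q a∉p b∈p a∈q b∉q
  rewrite occurs-∉ p a∉p | occurs-∈ p b∈p | occurs-∈ q a∈q | occurs-∉ q b∉q = refl

Together : Formula → ℕ → ℕ → Set
Together φ a b = Any (λ c → a ∈ c × b ∈ c) (dnf φ)

together-comm : ∀ φ {a b} → Together φ a b ⇔ Together φ b a
together-comm φ = mk⇔ (Any.map swap) (Any.map swap)

together⇒∈atoms : ∀ φ {a b} → Together φ a b → a ∈ atoms φ × b ∈ atoms φ
together⇒∈atoms φ t =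
  let c , c∈ , a∈c , b∈c = find t in clause⊆atoms φ c∈ a∈c , clause⊆atoms φ c∈ b∈c

together-nodeˡ : ∀ o p q {a b} → a ∉ atoms q → b ∉ atoms q →
  Together (node o p q) a b ⇔ Together p a b
together-nodeˡ OR p q {a} {b} a∉q _ = mk⇔ restrict Anyₚ.++⁺ˡ
  where
  restrict : Together (node OR p q) a b → Together p a b
  restrict t with Anyₚ.++⁻ (dnf p) t
  ... | inj₁ tp = tp
  ... | inj₂ tq = ⊥-elim (a∉q (proj₁ (together⇒∈atoms q tq)))
together-nodeˡ AND p q {a} {b} a∉q b∉q = mk⇔ restrict extend
  where
  restrict : Together (node AND p q) a b → Together p a b
  restrict t with find t
  ... | e , e∈ , a∈e , b∈e with ∈-dnf-∧⁻ p q e∈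
  ...   | c , d , c∈ , d∈ , refl = lose c∈
    ( ∈-++∧∉ʳ⇒∈ˡ c a∈e (a∉q ∘′ clause⊆atoms q d∈)
    , ∈-++∧∉ʳ⇒∈ˡ c b∈e (b∉q ∘′ clause⊆atoms q d∈))
  extend : Together p a b → Together (node AND p q) a b
  extend t =
    let c , c∈ , a∈c , b∈c = find t; d , d∈ = dnf-nonempty q
    in lose (∈-dnf-∧⁺ p q c∈ d∈) (∈-++⁺ˡ a∈c , ∈-++⁺ˡ b∈c)

together-nodeʳ : ∀ o p q {a b} → a ∉ atoms p → b ∉ atoms p →
  Together (node o p q) a b ⇔ Together q a b
together-nodeʳ OR p q {a} {b} a∉p _ = mk⇔ restrict (Anyₚ.++⁺ʳ (dnf p))
  where
  restrict : Together (node OR p q) a b → Together q a b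
  restrict t with Anyₚ.++⁻ (dnf p) t
  ... | inj₁ tp = ⊥-elim (a∉p (proj₁ (together⇒∈atoms p tp)))
  ... | inj₂ tq = tq
together-nodeʳ AND p q {a} {b} a∉p b∉p = mk⇔ restrict extend
  where
  restrict : Together (node AND p q) a b → Together q a b
  restrict t with find t
  ... | e , e∈ , a∈e , b∈e with ∈-dnf-∧⁻ p q e∈
  ...   | c , d , c∈ , d∈ , refl = lose d∈
    ( ∈-++∧∉ˡ⇒∈ʳ c a∈e (a∉p ∘′ clause⊆atoms p c∈)
    , ∈-++∧∉ˡ⇒∈ʳ c b∈e (b∉p ∘′ clause⊆atoms p c∈))
  extend : Together q a b → Together (node AND p q) a b
  extend t =
    let c , c∈ = dnf-nonempty p; d , d∈ , a∈d , b∈d = find t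
    in lose (∈-dnf-∧⁺ p q c∈ d∈) (∈-++⁺ʳ c a∈d , ∈-++⁺ʳ c b∈d)

together-across : ∀ o p q {a b} → a ∈ atoms p → b ∉ atoms p → a ∉ atoms q → b ∈ atoms q →
  Together (node o p q) a b ⇔ (just o ≡ just AND)
together-across OR p q {a} {b} _ b∉p a∉q _ = mk⇔ separated λ ()
  where
  separated : Together (node OR p q) a b → just OR ≡ just AND
  separated t with Anyₚ.++⁻ (dnf p) t
  ... | inj₁ tp = ⊥-elim (b∉p (proj₂ (together⇒∈atoms p tp)))
  ... | inj₂ tq = ⊥-elim (a∉q (proj₁ (together⇒∈atoms q tq)))
together-across AND p q a∈p _ _ b∈q = mk⇔ (λ _ → refl) λ _ →
  let c , c∈ , a∈c = atom∈clause p a∈p; d , d∈ , b∈d = atom∈clause q b∈q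
  in lose (∈-dnf-∧⁺ p q c∈ d∈) (∈-++⁺ˡ a∈c , ∈-++⁺ʳ c b∈d)

proposition2 : (φ : Formula) → Unique (atoms φ) →
    (a b : ℕ) → a ∈ atoms φ → b ∈ atoms φ → a ≢ b →
    (Any (λ c → a ∈ c × b ∈ c) (dnf φ) ⇔ (join φ a b ≡ just AND))
proposition2 (atom _) _ a b (here refl) (here refl) a≢b = ⊥-elim (a≢b refl)
proposition2 (node o p q) u a b a∈ b∈ a≢b
  with Unique-++⁻ (atoms p) u | ∈-++⁻ (atoms p) a∈ | ∈-++⁻ (atoms p) b∈
... | up , _ , p#q | inj₁ a∈p | inj₁ b∈p
  rewrite join-inˡ o p q a∈p b∈p =
  ⇔-trans (together-nodeˡ o p q (Disjoint⇒∉ʳ p#q a∈p) (Disjoint⇒∉ʳ p#q b∈p))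
          (proposition2 p up a b a∈p b∈p a≢b)
... | _ , uq , p#q | inj₂ a∈q | inj₂ b∈q
  rewrite join-inʳ o p q (Disjoint⇒∉ˡ p#q a∈q) a∈q b∈q =
  ⇔-trans (together-nodeʳ o p q (Disjoint⇒∉ˡ p#q a∈q) (Disjoint⇒∉ˡ p#q b∈q))
          (proposition2 q uq a b a∈q b∈q a≢b)
... | _ , _ , p#q | inj₁ a∈p | inj₂ b∈q
  rewrite join-across o p q a∈p (Disjoint⇒∉ˡ p#q b∈q) (Disjoint⇒∉ʳ p#q a∈p) b∈q =
  together-across o p q a∈p (Disjoint⇒∉ˡ p#q b∈q) (Disjoint⇒∉ʳ p#q a∈p) b∈q
... | _ , _ , p#q | inj₂ a∈q | inj₁ b∈p
  rewrite join-across′ o p q (Disjoint⇒∉ˡ p#q a∈q) b∈p a∈q (Disjoint⇒∉ʳ p#q b∈p) =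
  ⇔-trans (together-comm (node o p q))
          (together-across o p q b∈p (Disjoint⇒∉ˡ p#q a∈q) (Disjoint⇒∉ʳ p#q b∈p) a∈q)
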